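{- Let $H$ be a connected hypergraph with a minimal edge cut $F$, and let $\{ V_i: i \in I\}$ be a partition of $V(H)$ such that each $V_i$ is a union of the vertex sets of connected components of $H \backslash F$. (i) Suppose $H$ has an Euler family $\mathcal{F}$, and let $\alpha: F \to I^{[2]}$ be defined by $\alpha(f)=ij$ if the edge $f \in F$ is traversed by a trail in $\mathcal{F}$ via a vertex in $V_i$ and a vertex in $V_j$ (where $i=j$ is possible). Then $\alpha$ is an edge cut assignment and $H^{\alpha}$ has an Euler family obtained from $\mathcal{F}$ by replacing each $f \in F$ with $f^{\alpha}$. (ii) Conversely, if for some edge cut assignment $\alpha: F \to I^{[2]}$ the hypergraph $H^{\alpha}$ has an Euler family $\mathcal{F}^{\alpha}$, then $H$ has an Euler family obtained from $\mathcal{F}^{\alpha}$ by replacing each $f^{\alpha}$, for $f \in F$, with $f$.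
   Context: A hypergraph $H=(V,E)$: non-empty finite vertex set $V$ and finite multiset $E$ of subsets of $V$ (edges). Distinct $u,v$ are adjacent via $e$ if $u,v\in e$. A walk is $v_0e_1v_1\ldots e_kv_k$ with $v_{i-1},v_i$ adjacent via $e_i$; anchors are $v_0,\dots,v_k$; closed if $v_0=v_k$, $k\ge2$; trail if edges are pairwise distinct; it traverses edge $e$ via vertex $v$ if $ev$ or $ve$ is a consecutive subsequence. Connected components are maximal connected subhypergraphs without empty edges. An Euler family is a set of pairwise edge-disjoint and anchor-disjoint closed trails jointly traversing every edge. For $F\subseteq E$, $H\backslash F=(V,E-F)$. An edge cut is a set $[S,V-S]_H=\{e\in E: e\cap S\ne\emptyset\ne e\cap(V-S)\}$ for non-empty proper $S\subset V$; minimal if it properly contains no other edge cut. For finite $I$, $I^{[2]}=\{ij:i,j\in I\}$ is the set of unordered pairs with repetition allowed. An edge cut assignment is a map $\alpha:F\to I^{[2]}$ such that $\alpha(f)=ij$, $i\ne j$, implies $f\cap V_i\ne\emptyset\ne f\cap V_j$, and $\alpha(f)=ii$ implies $|f\cap V_i|\ge2$. For $e\in E$: $e^\alpha=e\cap(V_i\cup V_j)$ if $e\in F$, $\alpha(e)=ij$; $e^\alpha=e$ if $e\notin F$. $H^\alpha$ has vertex set $V(H)$ and edge multiset $\{\!\{e^\alpha:e\in E(H)\}\!\}$. -}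

module Defs where

open import Data.Nat using (ℕ; suc; _≤_)
open import Data.Fin using (Fin)
open import Data.Fin.Subset using (Subset; _∈_; _∉_; _∩_; _∪_; _⊆_; ∁; Nonempty; ∣_∣)
open import Data.Fin.Subset.Properties using (_∈?_)
open import Data.Vec using (tabulate)
open import Data.Bool using (Bool)
open import Data.Unit using (⊤)
open import Data.Empty using (⊥)
open import Data.List using (List; []; _∷_; length; map)
open import Data.List.Relation.Unary.All using (All)
open import Data.List.Relation.Unary.Any using (Any)
open import Data.List.Relation.Unary.AllPairs using (AllPairs)
open import Data.List.Relation.Unary.Unique.Propositional using (Unique)
import Data.List.Membership.Propositional as L
open import Data.Product using (Σ; ∃; _×_; _,_; proj₁; proj₂)
open import Data.Sum using (_⊎_)
open import Data.Fin using (_≟_)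
open import Relation.Binary.PropositionalEquality using (_≡_; _≢_)
open import Relation.Nullary using (¬_; yes; no)
open import Relation.Nullary.Decidable using (⌊_⌋)

-- Hypergraphs: vertex set Fin n, edge multiset indexed by Fin m
-- (distinct indices = distinct edges, even if equal as subsets).

record Hypergraph (n m : ℕ) : Set where
  constructor hypergraph
  field
    edge : Fin m → Subset n
open Hypergraph public

-- Walks, relative to an arbitrary edge family  E : X → Subset n.
-- A walk v₀ e₁ v₁ … e_k v_k is stored as its first anchor v₀ and the
-- list of steps (e₁ , v₁) ∷ … ∷ (e_k , v_k).

record Walk (n : ℕ) (X : Set) : Set where
  constructor walk
  field
    start : Fin n
    steps : List (X × Fin n)
open Walk public

module _ {n : ℕ} {X : Set} where

  AdjacentVia : (X → Subset n) → Fin n → X → Fin n → Set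
  AdjacentVia E u e v = u ≢ v × u ∈ E e × v ∈ E e

  ValidFrom : (X → Subset n) → Fin n → List (X × Fin n) → Set
  ValidFrom E u [] = ⊤
  ValidFrom E u ((e , v) ∷ s) = AdjacentVia E u e v × ValidFrom E v s

  IsWalk : (X → Subset n) → Walk n X → Set
  IsWalk E w = ValidFrom E (start w) (steps w)

  lastFrom : Fin n → List (X × Fin n) → Fin n
  lastFrom u [] = u
  lastFrom u ((e , v) ∷ s) = lastFrom v s

  finish : Walk n X → Fin n
  finish w = lastFrom (start w) (steps w)

  anchors : Walk n X → List (Fin n)
  anchors w = start w ∷ map proj₂ (steps w)

  edgesOf : Walk n X → List X
  edgesOf w = map proj₁ (steps w)

  IsClosed : Walk n X → Set
  IsClosed w = finish w ≡ start w × 2 ≤ length (steps w)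

  IsTrail : (X → Subset n) → Walk n X → Set
  IsTrail E w = IsWalk E w × Unique (edgesOf w)

  StepFrom : Fin n → List (X × Fin n) → Fin n → X → Fin n → Set
  StepFrom u [] a e b = ⊥
  StepFrom u ((e' , v) ∷ s) a e b = (u ≡ a × e' ≡ e × v ≡ b) ⊎ StepFrom v s a e b

  Step : Walk n X → Fin n → X → Fin n → Set
  Step w = StepFrom (start w) (steps w)

  TraversesVia : Walk n X → X → Fin n → Set
  TraversesVia w e v = ∃ λ a → Step w v e a ⊎ Step w a e v

  Traverses : Walk n X → X → Set
  Traverses w e = ∃ λ v → TraversesVia w e v

  EdgeDisjoint : Walk n X → Walk n X → Set
  EdgeDisjoint w w' = ∀ e → e L.∈ edgesOf w → ¬ (e L.∈ edgesOf w')

  AnchorDisjoint : Walk n X → Walk n X → Set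
  AnchorDisjoint w w' = ∀ v → v L.∈ anchors w → ¬ (v L.∈ anchors w')

  IsEulerFamily : (X → Subset n) → List (Walk n X) → Set
  IsEulerFamily E 𝓕 =
    All (λ w → IsTrail E w × IsClosed w) 𝓕 ×
    AllPairs (λ w w' → EdgeDisjoint w w' × AnchorDisjoint w w') 𝓕 ×
    (∀ e → Any (λ w → Traverses w e) 𝓕)

  ConnectedBy : (X → Subset n) → Fin n → Fin n → Set
  ConnectedBy E u v = ∃ λ (w : Walk n X) → IsWalk E w × start w ≡ u × finish w ≡ v

module _ {n m : ℕ} (H : Hypergraph n m) where

  IsConnected : Set
  IsConnected = ∀ u v → ConnectedBy (edge H) u v

  deleteEdges : (F : Subset m) → Σ (Fin m) (λ e → e ∉ F) → Subset n
  deleteEdges F (e , _) = edge H e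

  IsEdgeCutBy : Subset n → Subset m → Set
  IsEdgeCutBy S F = ∀ e → (e ∈ F → Nonempty (edge H e ∩ S) × Nonempty (edge H e ∩ ∁ S))
                  × (Nonempty (edge H e ∩ S) → Nonempty (edge H e ∩ ∁ S) → e ∈ F)

  IsEdgeCut : Subset m → Set
  IsEdgeCut F = ∃ λ S → Nonempty S × Nonempty (∁ S) × IsEdgeCutBy S F

  IsMinimalEdgeCut : Subset m → Set
  IsMinimalEdgeCut F = IsEdgeCut F × (∀ F' → IsEdgeCut F' → F' ⊆ F → F' ≡ F)

-- Partitions {V_i : i ∈ Fin p} of Fin n, given by the map v ↦ index of
-- its part; parts must be non-empty.

IsPartition : {n p : ℕ} → (Fin n → Fin p) → Set
IsPartition {n} {p} part = ∀ (i : Fin p) → ∃ λ v → part v ≡ i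

part-set : {n p : ℕ} → (Fin n → Fin p) → Fin p → Subset n
part-set part i = tabulate (λ v → ⌊ part v ≟ i ⌋)

-- each V_i is a union of vertex sets of connected components of H \ F:
-- vertices connected in H \ F lie in the same part
RespectsComponents : {n m p : ℕ} → Hypergraph n m → Subset m → (Fin n → Fin p) → Set
RespectsComponents H F part =
  ∀ u v → ConnectedBy (deleteEdges H F) u v → part u ≡ part v

-- I^[2] is represented by ordered pairs (i , j);
-- every notion below depends only on the unordered pair {i , j}.
-- α is a total map on edge indices; only its values on F matter.

Assignment : ℕ → ℕ → Set
Assignment m p = Fin m → Fin p × Fin p

IsEdgeCutAssignment : {n m p : ℕ} → Hypergraph n m → Subset m → (Fin n → Fin p)
                    → Assignment m p → Set
IsEdgeCutAssignment H F part α = ∀ f → f ∈ F →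
  let i = proj₁ (α f) ; j = proj₂ (α f) in
  (i ≢ j → Nonempty (edge H f ∩ part-set part i) × Nonempty (edge H f ∩ part-set part j)) ×
  (i ≡ j → 2 ≤ ∣ edge H f ∩ part-set part i ∣)

edgeα : {n m p : ℕ} → Hypergraph n m → Subset m → (Fin n → Fin p)
      → Assignment m p → Fin m → Subset n
edgeα H F part α e with e ∈? F
... | yes _ = edge H e ∩ (part-set part (proj₁ (α e)) ∪ part-set part (proj₂ (α e)))
... | no _ = edge H e

_^_under_,_ : {n m p : ℕ} → (H : Hypergraph n m) → Assignment m p → Subset m → (Fin n → Fin p)
            → Hypergraph n m
H ^ α under F , part = hypergraph (edgeα H F part α)

InducedBy : {n m p : ℕ} → Subset m → (Fin n → Fin p) → List (Walk n (Fin m))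
          → Assignment m p → Set
InducedBy F part 𝓕 α = ∀ f → f ∈ F →
  Any (λ w → ∃ λ a → ∃ λ b → Step w a f b ×
        ((part a ≡ proj₁ (α f) × part b ≡ proj₂ (α f)) ⊎
         (part a ≡ proj₂ (α f) × part b ≡ proj₁ (α f)))) 𝓕

-- An Euler family traverses each edge f exactly once, as one step a f b of one of
-- its trails.  Hence α(f) = {part a , part b} is well defined; the two distinct
-- vertices a, b of f witness that α is an edge cut assignment, and since they lie
-- in f^α every trail of the family is still a trail of H^α.  Conversely f^α ⊆ f,
-- so trails of H^α are trails of H.  Closedness, disjointness and traversal do
-- not depend on the vertex sets of the edges, so they carry over unchanged.
module Submission where

open import Defs
open import Data.Nat using (ℕ; suc; _≤_; s≤s; z≤n)
open import Data.Nat.Properties using (≤-trans)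
open import Data.Fin using (Fin; _≟_)
open import Data.Fin.Subset using (Subset; _∈_; _⊆_; _∩_; _∪_; ∣_∣; Nonempty)
open import Data.Fin.Subset.Properties
  using (_∈?_; x∈p∩q⁺; x∈p∩q⁻; x∈p∪q⁺; x∈p∧x≢y⇒x∈p-y; x∈p⇒∣p-x∣<∣p∣)
open import Data.Vec.Properties using (lookup⇒[]=; lookup∘tabulate)
open import Data.Unit using (tt)
open import Data.Empty using (⊥-elim)
open import Data.List using (List; []; _∷_; map)
open import Data.List.Relation.Unary.All as All using (All; _∷_)
open import Data.List.Relation.Unary.Any as Any using (Any; here; there)
open import Data.List.Relation.Unary.AllPairs as AllPairs using (AllPairs; _∷_)
open import Data.List.Relation.Unary.Unique.Propositional using (Unique)
import Data.List.Membership.Propositional as L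
open import Data.Product using (Σ; ∃₂; _×_; _,_; proj₁; proj₂)
open import Data.Sum using (_⊎_; inj₁; inj₂)
open import Function using (_∘_)
open import Relation.Binary.PropositionalEquality using (_≡_; _≢_; refl; sym; trans)
open import Relation.Nullary using (yes; no)
open import Relation.Nullary.Decidable using (dec-true; isYes≗does)

module _ {n : ℕ} {X : Set} where

  stepFrom-∈ : ∀ {u : Fin n} {s : List (X × Fin n)} {a e b} →
    StepFrom u s a e b → e L.∈ map proj₁ s
  stepFrom-∈ {s = _ ∷ _} (inj₁ (_ , refl , _)) = here refl
  stepFrom-∈ {s = _ ∷ _} (inj₂ st)             = there (stepFrom-∈ st)

  stepFrom-unique : ∀ {u : Fin n} {s : List (X × Fin n)} {a b a' b' e} →
    Unique (map proj₁ s) → StepFrom u s a e b → StepFrom u s a' e b' → a ≡ a' × b ≡ b'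
  stepFrom-unique {s = _ ∷ _} _ (inj₁ (refl , refl , refl)) (inj₁ (refl , _ , refl)) = refl , refl
  stepFrom-unique {s = _ ∷ _} (e∉ ∷ _) (inj₁ (_ , refl , _)) (inj₂ st') =
    ⊥-elim (All.lookup e∉ (stepFrom-∈ st') refl)
  stepFrom-unique {s = _ ∷ _} (e∉ ∷ _) (inj₂ st) (inj₁ (_ , refl , _)) =
    ⊥-elim (All.lookup e∉ (stepFrom-∈ st) refl)
  stepFrom-unique {s = _ ∷ _} (_ ∷ u) (inj₂ st) (inj₂ st') = stepFrom-unique u st st'

  stepFrom-adjacent : ∀ {E : X → Subset n} {u s a e b} →
    ValidFrom E u s → StepFrom u s a e b → AdjacentVia E a e b
  stepFrom-adjacent {s = _ ∷ _} (adj , _) (inj₁ (refl , refl , refl)) = adj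
  stepFrom-adjacent {s = _ ∷ _} (_ , vs)  (inj₂ st)                   = stepFrom-adjacent vs st

  ValidFrom-map : ∀ {E E' : X → Subset n} {u s} →
    (∀ {a e b} → StepFrom u s a e b → AdjacentVia E a e b → AdjacentVia E' a e b) →
    ValidFrom E u s → ValidFrom E' u s
  ValidFrom-map {s = []}    _ _ = tt
  ValidFrom-map {s = _ ∷ _} f (adj , vs) =
    f (inj₁ (refl , refl , refl)) adj , ValidFrom-map (f ∘ inj₂) vs

  AdjacentVia-mono : ∀ {E E' : X → Subset n} {a e b} →
    (∀ e → E e ⊆ E' e) → AdjacentVia E a e b → AdjacentVia E' a e b
  AdjacentVia-mono E⊆E' (a≢b , a∈ , b∈) = a≢b , E⊆E' _ a∈ , E⊆E' _ b∈

  traverses⇒step : ∀ {w : Walk n X} {e} → Traverses w e → ∃₂ λ a b → Step w a e b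
  traverses⇒step (v , a , inj₁ st) = v , a , st
  traverses⇒step (v , a , inj₂ st) = a , v , st

  step-unique : ∀ {𝓕 : List (Walk n X)} {w w' a b a' b' e} →
    AllPairs EdgeDisjoint 𝓕 → All (Unique ∘ edgesOf) 𝓕 →
    w L.∈ 𝓕 → w' L.∈ 𝓕 → Step w a e b → Step w' a' e b' → a ≡ a' × b ≡ b'
  step-unique _        (u ∷ _)  (here refl) (here refl) st st' = stepFrom-unique u st st'
  step-unique (d ∷ _)  _        (here refl) (there w'∈) st st' =
    ⊥-elim (All.lookup d w'∈ _ (stepFrom-∈ st) (stepFrom-∈ st'))
  step-unique (d ∷ _)  _        (there w∈)  (here refl) st st' =
    ⊥-elim (All.lookup d w∈ _ (stepFrom-∈ st') (stepFrom-∈ st))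
  step-unique (_ ∷ ds) (_ ∷ us) (there w∈)  (there w'∈) st st' = step-unique ds us w∈ w'∈ st st'

  module _ {E : X → Subset n} {𝓕 : List (Walk n X)} (euler : IsEulerFamily E 𝓕) where

    eulerFamily-step-unique : ∀ {w w' a b a' b' e} →
      w L.∈ 𝓕 → w' L.∈ 𝓕 → Step w a e b → Step w' a' e b' → a ≡ a' × b ≡ b'
    eulerFamily-step-unique =
      step-unique (AllPairs.map proj₁ (proj₁ (proj₂ euler))) (All.map (proj₂ ∘ proj₁) (proj₁ euler))

    eulerFamily-step-adjacent : ∀ {w a e b} → w L.∈ 𝓕 → Step w a e b → AdjacentVia E a e b
    eulerFamily-step-adjacent w∈ = stepFrom-adjacent (proj₁ (proj₁ (All.lookup (proj₁ euler) w∈)))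

  IsEulerFamily-map : ∀ {E E' : X → Subset n} {𝓕 : List (Walk n X)} →
    (∀ {w} → w L.∈ 𝓕 → IsWalk E w → IsWalk E' w) → IsEulerFamily E 𝓕 → IsEulerFamily E' 𝓕
  IsEulerFamily-map f (trails , disjoint , covers) =
    All.tabulate (λ w∈ → let (isWalk , unique) , closed = All.lookup trails w∈
                         in (f w∈ isWalk , unique) , closed)
    , disjoint , covers

two≤∣p∣ : ∀ {n} {x y : Fin n} {p : Subset n} → x ≢ y → x ∈ p → y ∈ p → 2 ≤ ∣ p ∣
-- y survives the removal of x, so ∣ p ∣ > ∣ p - x ∣ ≥ 1.
two≤∣p∣ x≢y x∈p y∈p =
  ≤-trans (s≤s (≤-trans (s≤s z≤n) (x∈p⇒∣p-x∣<∣p∣ (x∈p∧x≢y⇒x∈p-y y∈p (x≢y ∘ sym)))))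
          (x∈p⇒∣p-x∣<∣p∣ x∈p)

module _ {n p : ℕ} (part : Fin n → Fin p) where

  ∈-part-set : ∀ {v i} → part v ≡ i → v ∈ part-set part i
  ∈-part-set {v} refl = lookup⇒[]= v _
    (trans (lookup∘tabulate _ v)
           (trans (isYes≗does (part v ≟ part v)) (dec-true (part v ≟ part v) refl)))

  parts : Fin p × Fin p → Subset n
  parts ij = part-set part (proj₁ ij) ∪ part-set part (proj₂ ij)

  Joins : Fin p × Fin p → Fin n → Fin n → Set
  Joins ij a b = (part a ≡ proj₁ ij × part b ≡ proj₂ ij) ⊎ (part a ≡ proj₂ ij × part b ≡ proj₁ ij)

  joins⇒∈parts : ∀ {ij a b} → Joins ij a b → a ∈ parts ij × b ∈ parts ij
  joins⇒∈parts (inj₁ (a∈i , b∈j)) = x∈p∪q⁺ (inj₁ (∈-part-set a∈i)) , x∈p∪q⁺ (inj₂ (∈-part-set b∈j))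
  joins⇒∈parts (inj₂ (a∈j , b∈i)) = x∈p∪q⁺ (inj₂ (∈-part-set a∈j)) , x∈p∪q⁺ (inj₁ (∈-part-set b∈i))

  joins⇒cut-conditions : ∀ {i j a b} {e : Subset n} → a ≢ b → a ∈ e → b ∈ e → Joins (i , j) a b →
    (i ≢ j → Nonempty (e ∩ part-set part i) × Nonempty (e ∩ part-set part j)) ×
    (i ≡ j → 2 ≤ ∣ e ∩ part-set part i ∣)
  joins⇒cut-conditions a≢b a∈e b∈e (inj₁ (refl , refl)) =
    (λ _ → (_ , x∈p∩q⁺ (a∈e , ∈-part-set refl)) , (_ , x∈p∩q⁺ (b∈e , ∈-part-set refl))) ,
    (λ i≡j → two≤∣p∣ a≢b (x∈p∩q⁺ (a∈e , ∈-part-set refl)) (x∈p∩q⁺ (b∈e , ∈-part-set (sym i≡j))))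
  joins⇒cut-conditions a≢b a∈e b∈e (inj₂ (refl , refl)) =
    (λ _ → (_ , x∈p∩q⁺ (b∈e , ∈-part-set refl)) , (_ , x∈p∩q⁺ (a∈e , ∈-part-set refl))) ,
    (λ i≡j → two≤∣p∣ a≢b (x∈p∩q⁺ (a∈e , ∈-part-set (sym i≡j))) (x∈p∩q⁺ (b∈e , ∈-part-set refl)))

module _ {n m p : ℕ} (H : Hypergraph n m) (F : Subset m) (part : Fin n → Fin p) where

  edgeα⊆edge : ∀ α e → edgeα H F part α e ⊆ edge H e
  edgeα⊆edge α e x∈ with e ∈? F
  ... | yes _ = proj₁ (x∈p∩q⁻ (edge H e) _ x∈)
  ... | no _  = x∈

  ∈-edgeα : ∀ α e {x} → x ∈ edge H e → (e ∈ F → x ∈ parts part (α e)) → x ∈ edgeα H F part α e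
  ∈-edgeα α e x∈ x∈parts with e ∈? F
  ... | yes e∈F = x∈p∩q⁺ (x∈ , x∈parts e∈F)
  ... | no _    = x∈

  stepJoining : ∀ {𝓕 : List (Walk n (Fin m))} {e} → Any (λ w → Traverses w e) 𝓕 →
    Σ (Fin p × Fin p) λ ij → Any (λ w → ∃₂ λ a b → Step w a e b × Joins part ij a b) 𝓕
  stepJoining t with L.find (Any.map traverses⇒step t)
  ... | _ , w∈ , a , b , st = (part a , part b) , L.lose w∈ (a , b , st , inj₁ (refl , refl))

  inducedAssignment : ∀ {𝓕 : List (Walk n (Fin m))} → (∀ e → Any (λ w → Traverses w e) 𝓕) →
    Σ (Assignment m p) (InducedBy F part 𝓕)
  inducedAssignment covers =
    (λ e → proj₁ (stepJoining (covers e))) , (λ f _ → proj₂ (stepJoining (covers f)))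

  module _ {𝓕 : List (Walk n (Fin m))} {α : Assignment m p}
           (euler : IsEulerFamily (edge H) 𝓕) (induced : InducedBy F part 𝓕 α) where

    induced⇒joins : ∀ {w a f b} → w L.∈ 𝓕 → Step w a f b → f ∈ F → Joins part (α f) a b
    induced⇒joins w∈ st f∈F with L.find (induced _ f∈F)
    ... | _ , w'∈ , _ , _ , st' , joins with eulerFamily-step-unique euler w∈ w'∈ st st'
    ... | refl , refl = joins

    induced⇒edgeCutAssignment : IsEdgeCutAssignment H F part α
    induced⇒edgeCutAssignment f f∈F with L.find (induced f f∈F)
    ... | _ , w∈ , _ , _ , st , joins with eulerFamily-step-adjacent euler w∈ st
    ... | a≢b , a∈ , b∈ = joins⇒cut-conditions part a≢b a∈ b∈ joins

    eulerFamily-^α : IsEulerFamily (edgeα H F part α) 𝓕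
    eulerFamily-^α = IsEulerFamily-map (λ w∈ → ValidFrom-map (λ st → adjacent-in-^α (induced⇒joins w∈ st))) euler
      where
      adjacent-in-^α : ∀ {a e b} → (e ∈ F → Joins part (α e) a b) →
        AdjacentVia (edge H) a e b → AdjacentVia (edgeα H F part α) a e b
      adjacent-in-^α joins (a≢b , a∈ , b∈) =
        a≢b , ∈-edgeα α _ a∈ (proj₁ ∘ joins⇒∈parts part ∘ joins)
            , ∈-edgeα α _ b∈ (proj₂ ∘ joins⇒∈parts part ∘ joins)

  eulerFamily-from-^α : ∀ α {𝓕 : List (Walk n (Fin m))} →
    IsEulerFamily (edgeα H F part α) 𝓕 → IsEulerFamily (edge H) 𝓕
  eulerFamily-from-^α α = IsEulerFamily-map (λ _ → ValidFrom-map (λ _ → AdjacentVia-mono (edgeα⊆edge α)))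

lemma4p3 : ∀ {n m p : ℕ} (H : Hypergraph (suc n) m) (F : Subset m)
    (part : Fin (suc n) → Fin p) →
    IsConnected H → IsMinimalEdgeCut H F → IsPartition part →
    RespectsComponents H F part →
    -- (i)
    (∀ (𝓕 : List (Walk (suc n) (Fin m))) → IsEulerFamily (edge H) 𝓕 →
      Σ (Assignment m p) (InducedBy F part 𝓕) ×
      (∀ (α : Assignment m p) → InducedBy F part 𝓕 α →
        IsEdgeCutAssignment H F part α ×
        IsEulerFamily (edge (H ^ α under F , part)) 𝓕))
    ×
    -- (ii)
    (∀ (α : Assignment m p) → IsEdgeCutAssignment H F part α →
      ∀ (𝓕 : List (Walk (suc n) (Fin m))) →
      IsEulerFamily (edge (H ^ α under F , part)) 𝓕 → IsEulerFamily (edge H) 𝓕)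
lemma4p3 H F part _ _ _ _ =
  (λ 𝓕 euler → inducedAssignment H F part (proj₂ (proj₂ euler))
             , λ α induced → induced⇒edgeCutAssignment H F part euler induced
                           , eulerFamily-^α H F part euler induced)
  , λ α _ 𝓕 → eulerFamily-from-^α H F part α
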